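{- Let $n\ge 2$, $A=\{1\}$, and let $S:(x_1,\ldots,x_{n-1})$ be a sequence in $\mathbb{Z}_n$. Then $S$ is an $A$-extremal sequence if and only if for every $1\le i\le n-1$ we have $x_i\notin\{0,\,-x_{i-1},\,-x_{i-1}-x_{i-2},\,\ldots,\,-x_{i-1}-x_{i-2}-\cdots-x_1\}$. There are exactly $(n-1)!$ $A$-extremal sequences in $\mathbb{Z}_n$.
   Context: $\mathbb{Z}_n=\mathbb{Z}/n\mathbb{Z}$. For $B\subseteq\mathbb{Z}_n\setminus\{0\}$, a sequence $(x_1,\ldots,x_k)$ ($k\ge1$) in $\mathbb{Z}_n$ is a $B$-weighted zero-sum sequence if there exist $b_1,\ldots,b_k\in B$ with $b_1x_1+\cdots+b_kx_k=0$. A subsequence of consecutive terms is a nonempty block $(x_i,\ldots,x_j)$. $C_B(n)$ is the least positive integer $k$ such that every sequence of length $k$ in $\mathbb{Z}_n$ has a $B$-weighted zero-sum subsequence of consecutive terms. A sequence in $\mathbb{Z}_n$ is $B$-extremal if it has length $C_B(n)-1$ and has no $B$-weighted zero-sum subsequence of consecutive terms. -}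

module Defs where

open import Level using (0ℓ)
open import Data.Nat using (ℕ; zero; suc; _+_; _*_; _<_; _≤_)
open import Data.Nat.Divisibility using (_∣_)
open import Data.Fin using (Fin; toℕ)
open import Data.List using (List; []; _∷_; length; take; drop; map; zipWith; _++_)
open import Data.Nat.ListAction using (sum)
open import Data.List.Relation.Unary.All using (All)
open import Data.Product using (Σ; ∃; _×_)
open import Relation.Binary.PropositionalEquality using (_≡_; _≢_)
open import Relation.Nullary using (¬_)

-- ℤ_n is represented by Fin n (canonical residues 0 … n-1).
-- An element/sum is zero in ℤ_n iff n divides its natural-number representative.

wsum : ∀ {n} → List (Fin n) → List (Fin n) → ℕ
wsum bs xs = sum (zipWith (λ b x → toℕ b * toℕ x) bs xs)

WeightedZeroSum : (n : ℕ) → (Fin n → Set) → List (Fin n) → Set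
WeightedZeroSum n B xs =
  xs ≢ [] × (∃ λ (bs : List (Fin n)) → length bs ≡ length xs × All B bs × n ∣ wsum bs xs)

HasConsecZS : (n : ℕ) → (Fin n → Set) → List (Fin n) → Set
HasConsecZS n B xs =
  ∃ λ i → ∃ λ j → i < j × j ≤ length xs × WeightedZeroSum n B (drop i (take j xs))

AllHaveZS : (n : ℕ) → (Fin n → Set) → ℕ → Set
AllHaveZS n B k = (xs : List (Fin n)) → length xs ≡ k → HasConsecZS n B xs

IsC : (n : ℕ) → (Fin n → Set) → ℕ → Set
IsC n B k = 1 ≤ k × AllHaveZS n B k × ((k' : ℕ) → 1 ≤ k' → k' < k → ¬ AllHaveZS n B k')

Extremal : (n : ℕ) → (Fin n → Set) → List (Fin n) → Set
Extremal n B xs = IsC n B (suc (length xs)) × ¬ HasConsecZS n B xs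

A₁ : (n : ℕ) → Fin n → Set
A₁ n b = toℕ b ≡ 1

-- Condition: for each term x_i (S = pre ++ x_i ∷ post, pre = (x₁,…,x_{i-1})):
--   x_i ≠ 0, and x_i ≠ -(x_{i-1}+…+x_j) for every nonempty suffix (x_j,…,x_{i-1}) of pre,
--   i.e. n ∤ x_i + x_{i-1} + … + x_j.
Cond : (n : ℕ) → List (Fin n) → Set
Cond n S = (pre : List (Fin n)) (x : Fin n) (post : List (Fin n)) → S ≡ pre ++ x ∷ post →
  (toℕ x ≢ 0) × ((u v : List (Fin n)) → pre ≡ u ++ v → v ≢ [] → ¬ (n ∣ toℕ x + sum (map toℕ v)))

{-# OPTIONS --safe #-}
-- A sequence has no zero-sum block of consecutive terms iff its prefix sums 0, x₁, x₁ + x₂, …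
-- are pairwise distinct in ℤ_n.  Hence a zero-block-free sequence has length at most n - 1,
-- while the constant sequence 1, …, 1 of length n - 1 is zero-block free, so C_A(n) = n.
-- Growing a zero-block-free sequence at the front, a new first term x is admissible exactly
-- when it avoids the negatives of the prefix sums of the rest; for a rest of length k these
-- are k + 1 distinct residues, leaving n - 1 - k choices, so there are (n - 1)! extremal
-- sequences.
module Submission where

open import Defs
open import Data.Nat using (ℕ; zero; suc; _+_; _*_; _∸_; _≤_; _<_; s≤s; z<s; pred; NonZero; >-nonZero; _!)
open import Data.Nat.Properties
  using (+-identityʳ; +-assoc; +-comm; *-comm; *-identityˡ; suc-pred; suc-injective; ∸-+-assoc; m+n∸m≡n;
         m+[n∸m]≡n; m≤m+n; m<m+n; ≤-<-trans; <⇒≤; <⇒≢; <⇒≱; <-cmp)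
open import Data.Nat.Divisibility using (_∣_; _∣0; ∣m+n∣m⇒∣n; ∣⇒≤; m%n≡0⇒n∣m; n∣m⇒m%n≡0)
open import Data.Nat.DivMod
  using (_%_; _mod_; m%n<n; m%n%n≡m%n; %-distribˡ-+; m*n%n≡0; m<n⇒m%n≡m; [m+kn]%n≡m%n; %-remove-+ˡ)
open import Data.Nat.ListAction using (sum)
open import Data.Nat.ListAction.Properties using (sum-++)
open import Data.Nat.Combinatorics.Base using (_P′_)
open import Data.Nat.Combinatorics.Specification using (nP′n≡n!)
open import Data.Fin using (Fin; toℕ; fromℕ<)
open import Data.Fin.Properties using (toℕ-injective; toℕ<n; toℕ-fromℕ<) renaming (_≟_ to _≟ᶠ_)
open import Data.List
  using (List; []; _∷_; [_]; _++_; _∷ʳ_; length; map; take; drop; filter; concatMap; replicate; allFin;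
         _∷ʳ′_; initLast)
open import Data.List.Properties
  using (length-++; length-map; length-replicate; length-tabulate; map-++; ++-assoc; ++-identityʳ; ++-conicalʳ;
         ∷-injectiveˡ; ∷-injectiveʳ)
open import Data.List.Relation.Unary.All using (All; []; _∷_)
open import Data.List.Relation.Unary.All.Properties using (¬Any⇒All¬; ++⁻ˡ; ++⁻ʳ; replicate⁺)
open import Data.List.Relation.Unary.Any using (here; there)
open import Data.List.Relation.Unary.Unique.Propositional using (Unique; []; _∷_)
open import Data.List.Relation.Unary.Unique.Propositional.Properties
  using (++⁺; map⁺; filter⁺; allFin⁺; Unique[x∷xs]⇒x∉xs)
open import Data.List.Relation.Binary.Disjoint.Propositional using (Disjoint)
open import Data.List.Relation.Binary.Pointwise using (Pointwise-≡⇒≡; ≡⇒Pointwise-≡)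
open import Data.List.Relation.Binary.Prefix.Heterogeneous using (Prefix; []; _∷_)
import Data.List.Relation.Binary.Prefix.Heterogeneous.Properties as Prefix
open import Data.List.Relation.Binary.Infix.Heterogeneous
  using (Infix; here; there; _++ⁱ_; _ⁱ++_; MkView; toView)
import Data.List.Relation.Binary.Infix.Heterogeneous.Properties as Infix
open import Data.List.Relation.Binary.Permutation.Propositional using (_↭_; ↭-sym)
open import Data.List.Relation.Binary.Permutation.Propositional.Properties using (↭-length)
open import Data.List.Relation.Binary.BagAndSetEquality using (∼bag⇒↭)
open import Data.List.Membership.Propositional using (_∈_; _∉_; find; lose)
open import Data.List.Membership.Propositional.Properties
  using (∈-map⁺; ∈-map⁻; ∈-++⁺ˡ; ∈-++⁺ʳ; ∈-filter⁺; ∈-filter⁻; ∈-allFin; ∈-concatMap⁺; ∈-concatMap⁻)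
open import Data.List.Membership.Propositional.Properties.WithK using (unique∧set⇒bag)
open import Data.Product using (∃; ∃₂; _×_; _,_; proj₁; proj₂)
open import Data.Sum using (_⊎_; inj₁; inj₂; [_,_]′)
open import Function using (_∘_; id)
open import Function.Bundles using (_⇔_; mk⇔; Equivalence)
import Function.Properties.Equivalence as ⇔
open import Relation.Binary.Definitions using (tri<; tri≈; tri>)
open import Relation.Binary.PropositionalEquality using (_≡_; _≢_; refl; sym; trans; cong; cong₂; subst; module ≡-Reasoning)
open import Relation.Nullary using (¬_; Dec; yes; no; contradiction)
open import Relation.Nullary.Decidable using (map′; _⊎-dec_)

open Equivalence using (to; from)

IsC-unique : ∀ {n B k k′} → IsC n B k → IsC n B k′ → k ≡ k′
IsC-unique {k = k} {k′} (1≤k , zsk , least) (1≤k′ , zsk′ , least′) with <-cmp k k′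
... | tri< k<k′ _ _ = contradiction zsk (least′ k 1≤k k<k′)
... | tri≈ _ k≡k′ _ = k≡k′
... | tri> _ _ k′<k = contradiction zsk′ (least k′ 1≤k′ k′<k)

module _ {a} {A : Set a} where

  ≢[]⇒length>0 : ∀ {xs : List A} → xs ≢ [] → 0 < length xs
  ≢[]⇒length>0 {[]}    xs≢[] = contradiction refl xs≢[]
  ≢[]⇒length>0 {_ ∷ _} _     = z<s

  ∷ʳ≢[] : ∀ (xs : List A) x → xs ∷ʳ x ≢ []
  ∷ʳ≢[] xs x eq with () ← ++-conicalʳ xs [ x ] eq

  ++-∷ʳ-++ : ∀ (us vs : List A) x ws → us ++ (vs ∷ʳ x) ++ ws ≡ (us ++ vs) ++ x ∷ ws
  ++-∷ʳ-++ us vs x ws = trans (cong (us ++_) (++-assoc vs [ x ] ws)) (sym (++-assoc us vs (x ∷ ws)))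

  take-Prefix : ∀ j (xs : List A) → Prefix _≡_ (take j xs) xs
  take-Prefix zero    xs       = []
  take-Prefix (suc j) []       = []
  take-Prefix (suc j) (x ∷ xs) = refl ∷ take-Prefix j xs

  Prefix⇒take : ∀ {ws xs : List A} → Prefix _≡_ ws xs → take (length ws) xs ≡ ws
  Prefix⇒take []         = refl
  Prefix⇒take (refl ∷ p) = cong (_ ∷_) (Prefix⇒take p)

  drop-take-Infix : ∀ i j (xs : List A) → Infix _≡_ (drop i (take j xs)) xs
  drop-take-Infix zero    j       xs       = here (take-Prefix j xs)
  drop-take-Infix (suc i) zero    xs       = here []
  drop-take-Infix (suc i) (suc j) []       = here []
  drop-take-Infix (suc i) (suc j) (x ∷ xs) = there (drop-take-Infix i j xs)

  Infix⇒drop-take : ∀ {ws xs : List A} → Infix _≡_ ws xs →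
                    ∃ λ i → i + length ws ≤ length xs × drop i (take (i + length ws) xs) ≡ ws
  Infix⇒drop-take (here p)  = 0 , Prefix.length-mono p , Prefix⇒take p
  Infix⇒drop-take (there inf) with i , le , eq ← Infix⇒drop-take inf = suc i , s≤s le , eq

  ++-Infix : ∀ (us ws vs : List A) → Infix _≡_ ws (us ++ ws ++ vs)
  ++-Infix us ws vs = us ++ⁱ (Infix.fromPointwise (≡⇒Pointwise-≡ refl) ⁱ++ vs)

  Infix⇒++ : ∀ {ws xs : List A} → Infix _≡_ ws xs → ∃₂ λ us vs → xs ≡ us ++ ws ++ vs
  Infix⇒++ inf with MkView us pw vs ← toView inf =
    us , vs , cong (λ ws → us ++ ws ++ vs) (sym (Pointwise-≡⇒≡ pw))

module _ {a b} {A : Set a} {B : Set b} (f : A → List B) where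

  concatMap-Unique : (∀ x → Unique (f x)) → (∀ {x y v} → v ∈ f x → v ∈ f y → x ≡ y) →
                     ∀ {xs} → Unique xs → Unique (concatMap f xs)
  concatMap-Unique f! separated {[]}     []             = []
  concatMap-Unique f! separated {x ∷ xs} x∷xs!@(_ ∷ xs!) =
    ++⁺ (f! x) (concatMap-Unique f! separated xs!) disjoint
    where
    disjoint : Disjoint (f x) (concatMap f xs)
    disjoint (v∈fx , v∈rest) with y , y∈xs , v∈fy ← find (∈-concatMap⁻ f v∈rest) =
      Unique[x∷xs]⇒x∉xs x∷xs! (subst (_∈ xs) (sym (separated v∈fx v∈fy)) y∈xs)

  length-concatMap-const : ∀ {c xs} → (∀ {x} → x ∈ xs → length (f x) ≡ c) →
                           length (concatMap f xs) ≡ length xs * c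
  length-concatMap-const {c} {[]}     _   = refl
  length-concatMap-const {c} {x ∷ xs} len = begin
    length (f x ++ concatMap f xs)          ≡⟨ length-++ (f x) ⟩
    length (f x) + length (concatMap f xs)  ≡⟨ cong₂ _+_ (len (here refl)) (length-concatMap-const (len ∘ there)) ⟩
    c + length xs * c                       ∎
    where open ≡-Reasoning

module _ {n : ℕ} where

  open import Data.List.Membership.DecPropositional (_≟ᶠ_ {n}) using (_∈?_; _∉?_)

  complement : List (Fin n) → List (Fin n)
  complement F = filter (_∉? F) (allFin n)

  ∈-complement⁻ : ∀ {F x} → x ∈ complement F → x ∉ F
  ∈-complement⁻ x∈ = proj₂ (∈-filter⁻ (_∉? _) {xs = allFin n} x∈)

  ∈-complement⁺ : ∀ {F x} → x ∉ F → x ∈ complement F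
  ∈-complement⁺ x∉ = ∈-filter⁺ (_∉? _) (∈-allFin _) x∉

  complement-Unique : ∀ F → Unique (complement F)
  complement-Unique F = filter⁺ (_∉? F) (allFin⁺ n)

  length-complement : ∀ {F} → Unique F → length F + length (complement F) ≡ n
  length-complement {F} F! = begin
    length F + length (complement F)  ≡⟨ length-++ F ⟨
    length (F ++ complement F)        ≡⟨ ↭-length (↭-sym allFin↭) ⟩
    length (allFin n)                 ≡⟨ length-tabulate id ⟩
    n                                 ∎
    where
    open ≡-Reasoning
    covers : ∀ {x} → x ∈ F ++ complement F
    covers {x} with x ∈? F
    ... | yes x∈F = ∈-++⁺ˡ x∈F
    ... | no  x∉F = ∈-++⁺ʳ F (∈-complement⁺ x∉F)
    allFin↭ : allFin n ↭ F ++ complement F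
    allFin↭ = ∼bag⇒↭ (unique∧set⇒bag (allFin⁺ n)
      (++⁺ F! (complement-Unique F) (λ (x∈F , x∈C) → ∈-complement⁻ x∈C x∈F))
      (mk⇔ (λ _ → covers) (λ _ → ∈-allFin _)))

hasConsecZS⇔Infix : ∀ {n B xs} → HasConsecZS n B xs ⇔ (∃ λ ws → Infix _≡_ ws xs × WeightedZeroSum n B ws)
hasConsecZS⇔Infix {n} {B} {xs} = mk⇔
  (λ (i , j , _ , _ , zs) → drop i (take j xs) , drop-take-Infix i j xs , zs)
  λ (ws , inf , zs) → let i , le , eq = Infix⇒drop-take inf in
    i , i + length ws , m<m+n i (≢[]⇒length>0 (proj₁ zs)) , le , subst (WeightedZeroSum n B) (sym eq) zs

module Residues (n : ℕ) .{{_ : NonZero n}} where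

  -- (n - 1) t represents - t in ℤ_n
  neg : ℕ → Fin n
  neg t = (pred n * t) mod n

  private
    pred[n]*t+t≡t*n : ∀ t → pred n * t + t ≡ t * n
    pred[n]*t+t≡t*n t = begin
      pred n * t + t     ≡⟨ +-comm (pred n * t) t ⟩
      suc (pred n) * t   ≡⟨ cong (_* t) (suc-pred n) ⟩
      n * t              ≡⟨ *-comm n t ⟩
      t * n              ∎
      where open ≡-Reasoning

    toℕ-neg : ∀ t → toℕ (neg t) ≡ pred n * t % n
    toℕ-neg t = toℕ-fromℕ< (m%n<n (pred n * t) n)

  neg-inverse : ∀ t → n ∣ toℕ (neg t) + t
  neg-inverse t = m%n≡0⇒n∣m _ n (begin
    (toℕ (neg t) + t) % n        ≡⟨ cong (λ r → (r + t) % n) (toℕ-neg t) ⟩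
    (a % n + t) % n              ≡⟨ %-distribˡ-+ (a % n) t n ⟩
    (a % n % n + t % n) % n      ≡⟨ cong (λ r → (r + t % n) % n) (m%n%n≡m%n a n) ⟩
    (a % n + t % n) % n          ≡⟨ %-distribˡ-+ a t n ⟨
    (a + t) % n                  ≡⟨ cong (_% n) (pred[n]*t+t≡t*n t) ⟩
    (t * n) % n                  ≡⟨ m*n%n≡0 t n ⟩
    0                            ∎)
    where
    open ≡-Reasoning
    a = pred n * t

  neg-unique : ∀ {x : Fin n} {t} → n ∣ toℕ x + t → x ≡ neg t
  neg-unique {x} {t} n∣x+t = toℕ-injective (begin
    toℕ x                          ≡⟨ m<n⇒m%n≡m (toℕ<n x) ⟨
    toℕ x % n                      ≡⟨ [m+kn]%n≡m%n (toℕ x) t n ⟨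
    (toℕ x + t * n) % n            ≡⟨ cong (λ r → (toℕ x + r) % n) (pred[n]*t+t≡t*n t) ⟨
    (toℕ x + (a + t)) % n          ≡⟨ cong (λ r → (toℕ x + r) % n) (+-comm a t) ⟩
    (toℕ x + (t + a)) % n          ≡⟨ cong (_% n) (+-assoc (toℕ x) t a) ⟨
    (toℕ x + t + a) % n            ≡⟨ %-remove-+ˡ a n∣x+t ⟩
    a % n                          ≡⟨ toℕ-neg t ⟨
    toℕ (neg t)                    ∎)
    where
    open ≡-Reasoning
    a = pred n * t

  neg-cancelˡ : ∀ {a t} → n ∣ toℕ (neg a) + (a + t) → n ∣ t
  neg-cancelˡ {a} {t} d = ∣m+n∣m⇒∣n (subst (n ∣_) (sym (+-assoc (toℕ (neg a)) a t)) d) (neg-inverse a)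

  ∣toℕ⇒toℕ≡0 : ∀ {x : Fin n} → n ∣ toℕ x → toℕ x ≡ 0
  ∣toℕ⇒toℕ≡0 {x} d = trans (sym (m<n⇒m%n≡m (toℕ<n x))) (n∣m⇒m%n≡0 (toℕ x) n d)

module ZeroBlocks (n : ℕ) .{{_ : NonZero n}} where

  open Residues n
  open import Data.List.Membership.DecPropositional (_≟ᶠ_ {n}) using (_∈?_)

  repSum : List (Fin n) → ℕ
  repSum xs = sum (map toℕ xs)

  repSum-∷ʳ : ∀ vs x → repSum (vs ∷ʳ x) ≡ toℕ x + repSum vs
  repSum-∷ʳ vs x = begin
    sum (map toℕ (vs ++ [ x ]))           ≡⟨ cong sum (map-++ toℕ vs [ x ]) ⟩
    sum (map toℕ vs ++ [ toℕ x ])         ≡⟨ sum-++ (map toℕ vs) [ toℕ x ] ⟩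
    repSum vs + (toℕ x + 0)               ≡⟨ cong (repSum vs +_) (+-identityʳ (toℕ x)) ⟩
    repSum vs + toℕ x                     ≡⟨ +-comm (repSum vs) (toℕ x) ⟩
    toℕ x + repSum vs                     ∎
    where open ≡-Reasoning

  repSum-A₁ : ∀ {ws} → All (A₁ n) ws → repSum ws ≡ length ws
  repSum-A₁ []           = refl
  repSum-A₁ (w≡1 ∷ ws≡1) = cong₂ _+_ w≡1 (repSum-A₁ ws≡1)

  wsum-A₁ : ∀ bs ws → length bs ≡ length ws → All (A₁ n) bs → wsum bs ws ≡ repSum ws
  wsum-A₁ []       []       _   _            = refl
  wsum-A₁ (b ∷ bs) (w ∷ ws) len (b≡1 ∷ bs≡1) =
    cong₂ _+_ (trans (cong (_* toℕ w) b≡1) (*-identityˡ (toℕ w))) (wsum-A₁ bs ws (suc-injective len) bs≡1)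

  ZeroSum : List (Fin n) → Set
  ZeroSum ws = ws ≢ [] × n ∣ repSum ws

  ZeroBlock : List (Fin n) → Set
  ZeroBlock xs = ∃ λ ws → Infix _≡_ ws xs × ZeroSum ws

  ZeroBlockFree : List (Fin n) → Set
  ZeroBlockFree xs = ¬ ZeroBlock xs

  zeroBlockFree-[] : ZeroBlockFree []
  zeroBlockFree-[] (_ , here [] , []≢[] , _) = []≢[] refl

  zeroBlock-∷ʳ : ∀ {pre} us vs x post → pre ≡ us ++ vs → n ∣ toℕ x + repSum vs → ZeroBlock (pre ++ x ∷ post)
  zeroBlock-∷ʳ us vs x post refl d =
    vs ∷ʳ x ,
    subst (Infix _≡_ (vs ∷ʳ x)) (++-∷ʳ-++ us vs x post) (++-Infix us (vs ∷ʳ x) post) ,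
    ∷ʳ≢[] vs x ,
    subst (n ∣_) (sym (repSum-∷ʳ vs x)) d

  zeroBlockFree⇒cond : ∀ {S} → ZeroBlockFree S → Cond n S
  zeroBlockFree⇒cond free pre x post refl =
    (λ x≡0 → free (zeroBlock-∷ʳ pre [] x post (sym (++-identityʳ pre)) (subst (n ∣_) (sym (cong (_+ 0) x≡0)) (n ∣0)))) ,
    (λ us vs pre≡ _ d → free (zeroBlock-∷ʳ us vs x post pre≡ d))

  cond⇒¬zeroSum : ∀ {S} → Cond n S → ∀ us vs x post → S ≡ us ++ (vs ∷ʳ x) ++ post → ¬ n ∣ toℕ x + repSum vs
  cond⇒¬zeroSum c us []         x post S≡ d =
    proj₁ (c us x post S≡) (∣toℕ⇒toℕ≡0 (subst (n ∣_) (+-identityʳ (toℕ x)) d))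
  cond⇒¬zeroSum c us vs@(_ ∷ _) x post S≡ d =
    proj₂ (c (us ++ vs) x post (trans S≡ (++-∷ʳ-++ us vs x post))) us vs refl (λ ()) d

  cond⇒zeroBlockFree : ∀ {S} → Cond n S → ZeroBlockFree S
  cond⇒zeroBlockFree c (ws , inf , ws≢[] , d) with us , post , S≡ ← Infix⇒++ inf with initLast ws
  ... | []       = ws≢[] refl
  ... | vs ∷ʳ′ x = cond⇒¬zeroSum c us vs x post S≡ (subst (n ∣_) (repSum-∷ʳ vs x) d)

  cond⇔zeroBlockFree : ∀ {S} → Cond n S ⇔ ZeroBlockFree S
  cond⇔zeroBlockFree = mk⇔ cond⇒zeroBlockFree zeroBlockFree⇒cond

  -- forbiddenFrom a xs lists - (a + s) for the sums s of the prefixes of xs (the empty one included);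
  -- x ∷ xs has a zero-sum block starting at x iff x ∈ forbiddenFrom 0 xs.
  forbiddenFrom : ℕ → List (Fin n) → List (Fin n)
  forbiddenFrom a []       = neg a ∷ []
  forbiddenFrom a (y ∷ ys) = neg a ∷ forbiddenFrom (a + toℕ y) ys

  forbidden : List (Fin n) → List (Fin n)
  forbidden = forbiddenFrom 0

  length-forbiddenFrom : ∀ a xs → length (forbiddenFrom a xs) ≡ suc (length xs)
  length-forbiddenFrom a []       = refl
  length-forbiddenFrom a (y ∷ ys) = cong suc (length-forbiddenFrom (a + toℕ y) ys)

  ∈-forbiddenFrom⁻ : ∀ a xs {x} → x ∈ forbiddenFrom a xs →
                     ∃ λ ps → Prefix _≡_ ps xs × n ∣ toℕ x + (a + repSum ps)
  ∈-forbiddenFrom⁻ a []       (here refl) = [] , [] , subst (λ s → n ∣ toℕ (neg a) + s) (sym (+-identityʳ a)) (neg-inverse a)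
  ∈-forbiddenFrom⁻ a (_ ∷ _)  (here refl) = [] , [] , subst (λ s → n ∣ toℕ (neg a) + s) (sym (+-identityʳ a)) (neg-inverse a)
  ∈-forbiddenFrom⁻ a (y ∷ ys) {x} (there x∈) with ps , ps≼ys , d ← ∈-forbiddenFrom⁻ (a + toℕ y) ys x∈ =
    y ∷ ps , refl ∷ ps≼ys , subst (λ s → n ∣ toℕ x + s) (+-assoc a (toℕ y) (repSum ps)) d

  ∈-forbiddenFrom⁺ : ∀ a {xs ps x} → Prefix _≡_ ps xs → n ∣ toℕ x + (a + repSum ps) → x ∈ forbiddenFrom a xs
  ∈-forbiddenFrom⁺ a {[]}    {x = x} [] d = here (neg-unique (subst (λ s → n ∣ toℕ x + s) (+-identityʳ a) d))
  ∈-forbiddenFrom⁺ a {_ ∷ _} {x = x} [] d = here (neg-unique (subst (λ s → n ∣ toℕ x + s) (+-identityʳ a) d))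
  ∈-forbiddenFrom⁺ a {y ∷ _} {y ∷ ps} {x} (refl ∷ ps≼ys) d =
    there (∈-forbiddenFrom⁺ (a + toℕ y) ps≼ys (subst (λ s → n ∣ toℕ x + s) (sym (+-assoc a (toℕ y) (repSum ps))) d))

  zeroBlock-here : ∀ {x xs ps} → Prefix _≡_ ps xs → n ∣ toℕ x + repSum ps → ZeroBlock (x ∷ xs)
  zeroBlock-here {x} {ps = ps} ps≼xs d = x ∷ ps , here (refl ∷ ps≼xs) , (λ ()) , d

  zeroBlock-there : ∀ {x xs} → ZeroBlock xs → ZeroBlock (x ∷ xs)
  zeroBlock-there (ws , inf , zs) = ws , there inf , zs

  zeroBlock-∷⁻ : ∀ {x xs} → ZeroBlock (x ∷ xs) → x ∈ forbidden xs ⊎ ZeroBlock xs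
  zeroBlock-∷⁻ ([]     , _                  , []≢[] , _) = contradiction refl []≢[]
  zeroBlock-∷⁻ (_ ∷ _  , here (refl ∷ ps≼xs) , _     , d) = inj₁ (∈-forbiddenFrom⁺ 0 ps≼xs d)
  zeroBlock-∷⁻ (ws     , there inf          , zs)        = inj₂ (ws , inf , zs)

  zeroBlock-∷⁺ : ∀ {x xs} → x ∈ forbidden xs ⊎ ZeroBlock xs → ZeroBlock (x ∷ xs)
  zeroBlock-∷⁺ {xs = xs} (inj₁ x∈) with _ , ps≼xs , d ← ∈-forbiddenFrom⁻ 0 xs x∈ = zeroBlock-here ps≼xs d
  zeroBlock-∷⁺ (inj₂ zb) = zeroBlock-there zb

  zeroBlockFree-∷⁻ : ∀ {x xs} → ZeroBlockFree (x ∷ xs) → x ∉ forbidden xs × ZeroBlockFree xs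
  zeroBlockFree-∷⁻ free = free ∘ zeroBlock-∷⁺ ∘ inj₁ , free ∘ zeroBlock-∷⁺ ∘ inj₂

  zeroBlockFree-∷⁺ : ∀ {x xs} → x ∉ forbidden xs → ZeroBlockFree xs → ZeroBlockFree (x ∷ xs)
  zeroBlockFree-∷⁺ x∉ free = [ x∉ , free ]′ ∘ zeroBlock-∷⁻

  zeroBlock? : ∀ xs → Dec (ZeroBlock xs)
  zeroBlock? []       = no zeroBlockFree-[]
  zeroBlock? (x ∷ xs) = map′ zeroBlock-∷⁺ zeroBlock-∷⁻ (x ∈? forbidden xs ⊎-dec zeroBlock? xs)

  forbiddenFrom-Unique : ∀ a {xs} → ZeroBlockFree xs → Unique (forbiddenFrom a xs)
  forbiddenFrom-Unique a {[]}     _    = [] ∷ []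
  forbiddenFrom-Unique a {y ∷ ys} free =
    ¬Any⇒All¬ _ neg[a]∉ ∷ forbiddenFrom-Unique (a + toℕ y) (free ∘ zeroBlock-there)
    where
    neg[a]∉ : neg a ∉ forbiddenFrom (a + toℕ y) ys
    neg[a]∉ neg[a]∈ with ps , ps≼ys , d ← ∈-forbiddenFrom⁻ (a + toℕ y) ys neg[a]∈ =
      free (zeroBlock-here ps≼ys (neg-cancelˡ (subst (λ s → n ∣ toℕ (neg a) + s) (+-assoc a (toℕ y) (repSum ps)) d)))

  length-complement-forbidden : ∀ {xs} → ZeroBlockFree xs → suc (length xs) + length (complement (forbidden xs)) ≡ n
  length-complement-forbidden {xs} free =
    subst (λ l → l + length (complement (forbidden xs)) ≡ n) (length-forbiddenFrom 0 xs) (length-complement (forbiddenFrom-Unique 0 free))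

  zeroBlockFree⇒length< : ∀ {xs} → ZeroBlockFree xs → length xs < n
  zeroBlockFree⇒length< {xs} free =
    subst (suc (length xs) ≤_) (length-complement-forbidden free) (m≤m+n (suc (length xs)) _)

  extensions : List (Fin n) → List (List (Fin n))
  extensions xs = map (_∷ xs) (complement (forbidden xs))

  ∈-extensions⁻ : ∀ {xs ys} → ys ∈ extensions xs → ∃ λ x → x ∉ forbidden xs × ys ≡ x ∷ xs
  ∈-extensions⁻ ys∈ with x , x∈ , ys≡ ← ∈-map⁻ (_∷ _) ys∈ = x , ∈-complement⁻ x∈ , ys≡

  extensions-Unique : ∀ xs → Unique (extensions xs)
  extensions-Unique xs = map⁺ ∷-injectiveˡ (complement-Unique (forbidden xs))

  extensions-separated : ∀ {xs ys zs} → zs ∈ extensions xs → zs ∈ extensions ys → xs ≡ ys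
  extensions-separated zs∈ zs∈′ with _ , _ , refl ← ∈-extensions⁻ zs∈ | _ , _ , eq ← ∈-extensions⁻ zs∈′ =
    ∷-injectiveʳ eq

  freeSeqs : ℕ → List (List (Fin n))
  freeSeqs zero    = [] ∷ []
  freeSeqs (suc k) = concatMap extensions (freeSeqs k)

  ∈-freeSeqs⁻ : ∀ k {xs} → xs ∈ freeSeqs k → length xs ≡ k × ZeroBlockFree xs
  ∈-freeSeqs⁻ zero    (here refl) = refl , zeroBlockFree-[]
  ∈-freeSeqs⁻ (suc k) xs∈
    with ys , ys∈ , xs∈′ ← find (∈-concatMap⁻ extensions {xs = freeSeqs k} xs∈)
    with x , x∉ , refl ← ∈-extensions⁻ xs∈′
    with |ys|≡k , free ← ∈-freeSeqs⁻ k ys∈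
    = cong suc |ys|≡k , zeroBlockFree-∷⁺ x∉ free

  ∈-freeSeqs⁺ : ∀ {xs} → ZeroBlockFree xs → xs ∈ freeSeqs (length xs)
  ∈-freeSeqs⁺ {[]}     _    = here refl
  ∈-freeSeqs⁺ {x ∷ xs} free with x∉ , free′ ← zeroBlockFree-∷⁻ free =
    ∈-concatMap⁺ extensions (lose (∈-freeSeqs⁺ free′) (∈-map⁺ (_∷ xs) (∈-complement⁺ x∉)))

  ∈-freeSeqs⇔ : ∀ {k xs} → xs ∈ freeSeqs k ⇔ (length xs ≡ k × ZeroBlockFree xs)
  ∈-freeSeqs⇔ = mk⇔ (∈-freeSeqs⁻ _) λ where (refl , free) → ∈-freeSeqs⁺ free

  freeSeqs-Unique : ∀ k → Unique (freeSeqs k)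
  freeSeqs-Unique zero    = [] ∷ []
  freeSeqs-Unique (suc k) = concatMap-Unique extensions extensions-Unique extensions-separated (freeSeqs-Unique k)

  length-extensions : ∀ {k xs} → xs ∈ freeSeqs k → length (extensions xs) ≡ n ∸ suc k
  length-extensions {k} {xs} xs∈ with |xs|≡k , free ← ∈-freeSeqs⁻ k xs∈ = begin
    length (extensions xs)                                             ≡⟨ length-map (_∷ xs) C ⟩
    length C                                                           ≡⟨ m+n∸m≡n (suc (length xs)) (length C) ⟨
    suc (length xs) + length C ∸ suc (length xs)                       ≡⟨ cong₂ _∸_ (length-complement-forbidden free) (cong suc |xs|≡k) ⟩
    n ∸ suc k                                                          ∎
    where
    open ≡-Reasoning
    C = complement (forbidden xs)

  length-freeSeqs : ∀ k → length (freeSeqs k) ≡ (n ∸ 1) P′ k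
  length-freeSeqs zero    = refl
  length-freeSeqs (suc k) = begin
    length (concatMap extensions (freeSeqs k))  ≡⟨ length-concatMap-const extensions (length-extensions {k}) ⟩
    length (freeSeqs k) * (n ∸ suc k)           ≡⟨ cong₂ _*_ (length-freeSeqs k) (sym (∸-+-assoc n 1 k)) ⟩
    ((n ∸ 1) P′ k) * (n ∸ 1 ∸ k)                ≡⟨ *-comm ((n ∸ 1) P′ k) (n ∸ 1 ∸ k) ⟩
    (n ∸ 1) P′ suc k                            ∎
    where open ≡-Reasoning

module Weights (n : ℕ) .{{_ : NonZero n}} (1<n : 1 < n) where

  open ZeroBlocks n

  one : Fin n
  one = fromℕ< 1<n

  one∈A₁ : A₁ n one
  one∈A₁ = toℕ-fromℕ< 1<n

  weightedZeroSum⇔zeroSum : ∀ {ws} → WeightedZeroSum n (A₁ n) ws ⇔ ZeroSum ws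
  weightedZeroSum⇔zeroSum {ws} = mk⇔
    (λ (ws≢[] , bs , len , bs≡1 , d) → ws≢[] , subst (n ∣_) (wsum-A₁ bs ws len bs≡1) d)
    (λ (ws≢[] , d) → ws≢[] , ones , length-replicate (length ws) , ones≡1 ,
                     subst (n ∣_) (sym (wsum-A₁ ones ws (length-replicate (length ws)) ones≡1)) d)
    where
    ones = replicate (length ws) one
    ones≡1 = replicate⁺ (length ws) one∈A₁

  hasConsecZS⇔zeroBlock : ∀ {xs} → HasConsecZS n (A₁ n) xs ⇔ ZeroBlock xs
  hasConsecZS⇔zeroBlock = ⇔.trans hasConsecZS⇔Infix (mk⇔
    (λ (ws , inf , zs) → ws , inf , to weightedZeroSum⇔zeroSum zs)
    (λ (ws , inf , zs) → ws , inf , from weightedZeroSum⇔zeroSum zs))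

  replicate-zeroBlockFree : ∀ {k} → k < n → ZeroBlockFree (replicate k one)
  replicate-zeroBlockFree _ ([] , _ , []≢[] , _) = []≢[] refl
  replicate-zeroBlockFree {k} k<n (ws@(_ ∷ _) , inf , _ , n∣Σws) = <⇒≱ |ws|<n (∣⇒≤ n∣|ws|)
    where
    |ws|<n : length ws < n
    |ws|<n = ≤-<-trans (subst (length ws ≤_) (length-replicate k) (Infix.length-mono inf)) k<n
    ws≡1 : All (A₁ n) ws
    ws≡1 with us , vs , eq ← Infix⇒++ inf = ++⁻ˡ ws (++⁻ʳ us (subst (All (A₁ n)) eq (replicate⁺ k one∈A₁)))
    n∣|ws| : n ∣ length ws
    n∣|ws| = subst (n ∣_) (repSum-A₁ ws≡1) n∣Σws

  C-A₁≡n : IsC n (A₁ n) n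
  C-A₁≡n = <⇒≤ 1<n , lengthN-hasZS , shorter-free
    where
    lengthN-hasZS : AllHaveZS n (A₁ n) n
    lengthN-hasZS xs |xs|≡n with zeroBlock? xs
    ... | yes zb   = from hasConsecZS⇔zeroBlock zb
    ... | no  free = contradiction |xs|≡n (<⇒≢ (zeroBlockFree⇒length< free))
    shorter-free : ∀ k → 1 ≤ k → k < n → ¬ AllHaveZS n (A₁ n) k
    shorter-free k _ k<n allZS =
      replicate-zeroBlockFree k<n (to hasConsecZS⇔zeroBlock (allZS (replicate k one) (length-replicate k)))

  extremal⇔ : ∀ {S} → Extremal n (A₁ n) S ⇔ (length S ≡ n ∸ 1 × ZeroBlockFree S)
  extremal⇔ = mk⇔
    (λ (isC , noZS) → cong (_∸ 1) (IsC-unique isC C-A₁≡n) , noZS ∘ from hasConsecZS⇔zeroBlock)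
    (λ (|S|≡ , free) → subst (IsC n (A₁ n)) (sym (trans (cong suc |S|≡) (m+[n∸m]≡n (<⇒≤ 1<n)))) C-A₁≡n ,
                       free ∘ to hasConsecZS⇔zeroBlock)

mainTheorem12 : (n : ℕ) → 2 ≤ n →
    ((S : List (Fin n)) → length S ≡ n ∸ 1 → (Extremal n (A₁ n) S ⇔ Cond n S))
    × (∃ λ (L : List (List (Fin n))) → Unique L × length L ≡ (n ∸ 1) ! ×
    ((S : List (Fin n)) → (S ∈ L ⇔ Extremal n (A₁ n) S)))
mainTheorem12 n 1<n =
  (λ S |S|≡ → ⇔.trans extremal⇔ (⇔.trans (mk⇔ proj₂ (|S|≡ ,_)) (⇔.sym cond⇔zeroBlockFree))) ,
  freeSeqs (n ∸ 1) ,
  freeSeqs-Unique (n ∸ 1) ,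
  trans (length-freeSeqs (n ∸ 1)) (nP′n≡n! (n ∸ 1)) ,
  (λ S → ⇔.trans ∈-freeSeqs⇔ (⇔.sym extremal⇔))
  where
  instance
    n≢0 : NonZero n
    n≢0 = >-nonZero (<⇒≤ 1<n)
  open ZeroBlocks n
  open Weights n 1<n
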